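{- Let $G$ and $H$ be graphs which are not paths. Then for any vertex $v$ of $G$ and any vertex of $H$ identified with it, the vertex sum $G\oplus_v H$ admits a barbell partition.
   Context: All graphs are finite and simple. The vertex sum $G\oplus_v H$ is the graph obtained from disjoint copies of $G$ and $H$ by identifying a chosen vertex of $G$ with a chosen vertex of $H$, the identified vertex being called $v$. A barbell partition of a graph $K$ is a partition of $V(K)$ into three disjoint sets $\{R,W_1,W_2\}$ with $W_1,W_2\neq\emptyset$ ($R$ may be empty), no edges between $W_1$ and $W_2$, and $|N_K(r)\cap W_i|\neq 1$ for all $r\in R$, $i\in\{1,2\}$. -}

module Defs where

open import Data.Nat using (ℕ; zero; suc; _+_)
open import Data.Bool using (Bool; true; false; _∧_; _∨_; if_then_else_)
open import Data.Fin using (Fin; toℕ; splitAt; punchIn)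
open import Data.Fin.Properties using () renaming (_≟_ to _≟ᶠ_)
open import Data.List using (allFin; filterᵇ; length)
open import Data.Sum using (_⊎_; inj₁; inj₂)
open import Data.Product using (Σ; ∃; _×_; _,_)
open import Relation.Nullary using (¬_; does)
open import Relation.Binary.PropositionalEquality using (_≡_; _≢_)
open import Function.Bundles using (_↔_; Inverse)

record Graph (n : ℕ) : Set where
  field
    adj    : Fin n → Fin n → Bool
    sym    : ∀ i j → adj i j ≡ adj j i
    irrefl : ∀ i → adj i i ≡ false
open Graph public

_==ᶠ_ : ∀ {n} → Fin n → Fin n → Bool
i ==ᶠ j = does (i ≟ᶠ j)

_==ℕ_ : ℕ → ℕ → Bool
zero ==ℕ zero = true
zero ==ℕ suc _ = false
suc _ ==ℕ zero = false
suc a ==ℕ suc b = a ==ℕ b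

pathAdj : ∀ {n} → Fin n → Fin n → Bool
pathAdj i j = ((suc (toℕ i)) ==ℕ toℕ j) ∨ ((suc (toℕ j)) ==ℕ toℕ i)

IsPath : ∀ {n} → Graph n → Set
IsPath {n} G = Σ (Fin n ↔ Fin n) λ σ →
  ∀ i j → adj G i j ≡ pathAdj (Inverse.to σ i) (Inverse.to σ j)

-- Vertex set Fin (m + k): the first m vertices are those of G (u is the
-- identified vertex v); vertex raise m a corresponds to the vertex
-- punchIn w a of H (i.e. the vertices of H other than w).
sumAdj : ∀ {m k} → Graph m → Fin m → Graph (suc k) → Fin (suc k) →
         Fin (m + k) → Fin (m + k) → Bool
sumAdj {m} G u H w x y with splitAt m x | splitAt m y
... | inj₁ i | inj₁ j = adj G i j
... | inj₂ a | inj₂ b = adj H (punchIn w a) (punchIn w b)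
... | inj₁ i | inj₂ b = (i ==ᶠ u) ∧ adj H w (punchIn w b)
... | inj₂ a | inj₁ j = (j ==ᶠ u) ∧ adj H (punchIn w a) w

-- The vertex-sum graph itself (the adjacency above is symmetric and
-- irreflexive; we keep the graph as its adjacency relation).
VertexSum : ∀ {m k} → Graph m → Fin m → Graph (suc k) → Fin (suc k) →
            Fin (m + k) → Fin (m + k) → Bool
VertexSum = sumAdj

data Part : Set where
  R W₁ W₂ : Part

_==ᴾ_ : Part → Part → Bool
R ==ᴾ R = true
W₁ ==ᴾ W₁ = true
W₂ ==ᴾ W₂ = true
_ ==ᴾ _ = false

nbrsIn : ∀ {N} → (Fin N → Fin N → Bool) → (Fin N → Part) → Fin N → Part → ℕ
nbrsIn {N} K f r c = length (filterᵇ (λ x → K r x ∧ (f x ==ᴾ c)) (allFin N))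

record IsBarbellPartition {N : ℕ} (K : Fin N → Fin N → Bool) (f : Fin N → Part) : Set where
  field
    W₁-nonempty : ∃ λ x → f x ≡ W₁
    W₂-nonempty : ∃ λ x → f x ≡ W₂
    no-W₁W₂-edge : ∀ x y → f x ≡ W₁ → f y ≡ W₂ → K x y ≡ false
    R-nbrs₁ : ∀ r → f r ≡ R → nbrsIn K f r W₁ ≢ 1
    R-nbrs₂ : ∀ r → f r ≡ R → nbrsIn K f r W₂ ≢ 1

HasBarbellPartition : ∀ {N} → (Fin N → Fin N → Bool) → Set
HasBarbellPartition {N} K = ∃ λ (f : Fin N → Part) → IsBarbellPartition K f

{-# OPTIONS --safe #-}
module Submission where

-- Call W ⊆ V(G) ∖ {u} a barbell side of G at u if it is nonempty and no vertex outside W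
-- has exactly one neighbour in W. Sides of G at u and of H at w give a barbell partition of
-- G ⊕ᵥ H with W₁ and W₂ the two sides: v is the only vertex adjacent to both halves, it lies
-- in R, and its neighbours in the H-side are its neighbours in H.
-- A graph that is not a path has a side at every vertex u: grow an induced path from u at
-- one free end, adding the unique neighbour off the path as long as there is exactly one.
-- All other path vertices have no neighbours off the path, so when the growth stops the
-- off-path vertices form a side, unless the path has swallowed the whole graph, which is
-- then a path.

open import Defs hiding (sym)
open import Data.Bool using (Bool; true; false; _∧_; not; if_then_else_)
open import Data.Bool.Properties using (∧-zeroʳ; ∧-identityʳ)
open import Data.Empty using (⊥-elim)
open import Data.Fin using (Fin; zero; suc; splitAt; punchIn; punchOut; _↑ˡ_; _↑ʳ_)
open import Data.Fin.Properties
  using (splitAt-↑ˡ; splitAt-↑ʳ; splitAt⁻¹-↑ˡ; splitAt⁻¹-↑ʳ; punchInᵢ≢i; punchIn-punchOut; any?)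
  renaming (_≟_ to _≟ᶠ_)
open import Data.Fin.Permutation using (↔⇒≡)
open import Data.List using (filterᵇ; length; tabulate)
open import Data.Nat using (ℕ; zero; suc; _+_) renaming (_≟_ to _≟ℕ_)
open import Data.Nat.Properties using (+-identityʳ; suc-injective; 0≢1+n)
open import Data.Product using (∃; _×_; _,_; proj₁; proj₂)
open import Data.Sum using (inj₁; inj₂; [_,_]′)
open import Data.Vec.Functional using (_∷_)
open import Function using (_∘_; id)
open import Function.Bundles using (_⇔_; mk⇔; mk↔ₛ′)
open import Relation.Nullary using (¬_; Dec; does; yes; no; ¬?)
open import Relation.Nullary.Decidable using (dec-true; dec-false; decidable-stable; does-⇔)
open import Relation.Binary.PropositionalEquality
  using (_≡_; _≢_; refl; sym; trans; cong; cong₂; subst)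

∧-false : ∀ a b → a ∧ (b ∧ false) ≡ false
∧-false a b = trans (cong (a ∧_) (∧-zeroʳ b)) (∧-zeroʳ a)

∧≡true⇒ : ∀ {a b} → a ∧ b ≡ true → a ≡ true × b ≡ true
∧≡true⇒ {true} b≡true = refl , b≡true

does≡true⇒ : ∀ {a} {A : Set a} (a? : Dec A) → does a? ≡ true → A
does≡true⇒ (yes a) _ = a

does≡false⇒ : ∀ {a} {A : Set a} (a? : Dec A) → does a? ≡ false → ¬ A
does≡false⇒ (no ¬a) _ = ¬a

count : ∀ {n} → (Fin n → Bool) → ℕ
count {zero}  p = 0
count {suc n} p = if p zero then suc (count (p ∘ suc)) else count (p ∘ suc)

length-filterᵇ-tabulate : ∀ {n} {A : Set} (p : A → Bool) (f : Fin n → A) →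
  length (filterᵇ p (tabulate f)) ≡ count (p ∘ f)
length-filterᵇ-tabulate {zero}  p f = refl
length-filterᵇ-tabulate {suc n} p f with p (f zero)
... | true  = cong suc (length-filterᵇ-tabulate p (f ∘ suc))
... | false = length-filterᵇ-tabulate p (f ∘ suc)

nbrsIn≡count : ∀ {N} (K : Fin N → Fin N → Bool) f r c →
  nbrsIn K f r c ≡ count (λ x → K r x ∧ (f x ==ᴾ c))
nbrsIn≡count K f r c = length-filterᵇ-tabulate (λ x → K r x ∧ (f x ==ᴾ c)) id

count-cong : ∀ {n} {p q : Fin n → Bool} → (∀ i → p i ≡ q i) → count p ≡ count q
count-cong {zero}  e = refl
count-cong {suc n} {p} {q} e rewrite e zero with q zero
... | true  = cong suc (count-cong (λ i → e (suc i)))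
... | false = count-cong (λ i → e (suc i))

count-false : ∀ {n} {p : Fin n → Bool} → (∀ i → p i ≡ false) → count p ≡ 0
count-false {zero}  e = refl
count-false {suc n} e rewrite e zero = count-false (λ i → e (suc i))

count≡0⇒false : ∀ {n} {p : Fin n → Bool} → count p ≡ 0 → ∀ i → p i ≡ false
count≡0⇒false {suc n} {p} e i with p zero in eq
count≡0⇒false {suc n} {p} e zero    | false = eq
count≡0⇒false {suc n} {p} e (suc i) | false = count≡0⇒false e i

count≡suc⇒∃ : ∀ {n} {p : Fin n → Bool} {c} → count p ≡ suc c → ∃ λ i → p i ≡ true
count≡suc⇒∃ {suc n} {p} e with p zero in eq
... | true  = zero , eq
... | false = let i , pi = count≡suc⇒∃ e in suc i , pi

count-↑ : ∀ {m k} (p : Fin (m + k) → Bool) →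
  count p ≡ count (λ i → p (i ↑ˡ k)) + count (λ j → p (m ↑ʳ j))
count-↑ {zero}  p = refl
count-↑ {suc m} {k} p with p zero
... | true  = cong suc (count-↑ {m} {k} (p ∘ suc))
... | false = count-↑ {m} {k} (p ∘ suc)

count-punchIn-true : ∀ {k} (p : Fin (suc k) → Bool) w → p w ≡ true →
  count p ≡ suc (count (p ∘ punchIn w))
count-punchIn-true p zero e rewrite e = refl
count-punchIn-true {suc k} p (suc w) e with p zero
... | true  = cong suc (count-punchIn-true (p ∘ suc) w e)
... | false = count-punchIn-true (p ∘ suc) w e

count-punchIn-false : ∀ {k} (p : Fin (suc k) → Bool) w → p w ≡ false →
  count p ≡ count (p ∘ punchIn w)
count-punchIn-false p zero e rewrite e = refl
count-punchIn-false {suc k} p (suc w) e with p zero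
... | true  = cong suc (count-punchIn-false (p ∘ suc) w e)
... | false = count-punchIn-false (p ∘ suc) w e

count≡1⇒others-false : ∀ {n} {p : Fin n → Bool} → count p ≡ 1 →
  ∀ {y z} → p y ≡ true → z ≢ y → p z ≡ false
count≡1⇒others-false {suc n} {p} e {y} py z≢y =
  trans (cong p (sym (punchIn-punchOut (λ y≡z → z≢y (sym y≡z)))))
        (count≡0⇒false {p = p ∘ punchIn y}
          (suc-injective (trans (sym (count-punchIn-true p y py)) e)) _)

count≡1⇒unique : ∀ {n} {p : Fin n → Bool} → count p ≡ 1 →
  ∀ {y z} → p y ≡ true → p z ≡ true → y ≡ z
count≡1⇒unique e {y} {z} py pz with y ≟ᶠ z
... | yes y≡z = y≡z
... | no  y≢z with () ← trans (sym pz) (count≡1⇒others-false e py (λ z≡y → y≢z (sym z≡y)))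

count-remove : ∀ {n} (p q : Fin n → Bool) y → p y ≡ true → q y ≡ false →
  (∀ z → z ≢ y → p z ≡ q z) → count p ≡ suc (count q)
count-remove {suc n} p q y py qy p≗q = trans (count-punchIn-true p y py) (cong suc
  (trans (count-cong (λ j → p≗q (punchIn y j) (punchInᵢ≢i y j)))
         (sym (count-punchIn-false q y qy))))

record BarbellSide {m} (G : Graph m) (u : Fin m) : Set where
  field
    W             : Fin m → Bool
    u∉W           : W u ≡ false
    W-nonempty    : ∃ λ x → W x ≡ true
    no-single-nbr : ∀ r → W r ≡ false → count (λ y → adj G r y ∧ W y) ≢ 1

mark : Part → Bool → Part
mark c b = if b then c else R

mark-==ᴾ : ∀ c b d → d ≢ R → (mark c b ==ᴾ d) ≡ b ∧ (c ==ᴾ d)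
mark-==ᴾ c true  d  _   = refl
mark-==ᴾ c false R  d≢R = ⊥-elim (d≢R refl)
mark-==ᴾ c false W₁ _   = refl
mark-==ᴾ c false W₂ _   = refl

mark≡ : ∀ {c b d} → mark c b ≡ d → d ≢ R → c ≡ d × b ≡ true
mark≡ {b = true}  refl _   = refl , refl
mark≡ {b = false} refl R≢R = ⊥-elim (R≢R refl)

mark≡R : ∀ {c b} → c ≢ R → mark c b ≡ R → b ≡ false
mark≡R {b = true}  c≢R c≡R = ⊥-elim (c≢R c≡R)
mark≡R {b = false} _   _   = refl

data SumView m k : Fin (m + k) → Set where
  left  : (i : Fin m) → SumView m k (i ↑ˡ k)
  right : (b : Fin k) → SumView m k (m ↑ʳ b)

sumView : ∀ m {k} (x : Fin (m + k)) → SumView m k x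
sumView m x with splitAt m x in eq
... | inj₁ i = subst (SumView m _) (splitAt⁻¹-↑ˡ eq) (left i)
... | inj₂ b = subst (SumView m _) (splitAt⁻¹-↑ʳ eq) (right b)

module _ {m k} (G : Graph m) (u : Fin m) (H : Graph (suc k)) (w : Fin (suc k)) where

  private
    K = VertexSum G u H w
    pI = punchIn w

  sumAdj-↑ˡ-↑ˡ : ∀ i j → K (i ↑ˡ k) (j ↑ˡ k) ≡ adj G i j
  sumAdj-↑ˡ-↑ˡ i j rewrite splitAt-↑ˡ m i k | splitAt-↑ˡ m j k = refl

  sumAdj-↑ˡ-↑ʳ : ∀ i b → K (i ↑ˡ k) (m ↑ʳ b) ≡ (i ==ᶠ u) ∧ adj H w (pI b)
  sumAdj-↑ˡ-↑ʳ i b rewrite splitAt-↑ˡ m i k | splitAt-↑ʳ m k b = refl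

  sumAdj-u-↑ʳ : ∀ b → K (u ↑ˡ k) (m ↑ʳ b) ≡ adj H w (pI b)
  sumAdj-u-↑ʳ b = trans (sumAdj-↑ˡ-↑ʳ u b) (cong (_∧ adj H w (pI b)) (dec-true (u ≟ᶠ u) refl))

  sumAdj-≢u-↑ʳ : ∀ {i} → i ≢ u → ∀ b → K (i ↑ˡ k) (m ↑ʳ b) ≡ false
  sumAdj-≢u-↑ʳ {i} i≢u b = trans (sumAdj-↑ˡ-↑ʳ i b) (cong (_∧ adj H w (pI b)) (dec-false (i ≟ᶠ u) i≢u))

  sumAdj-↑ʳ-↑ˡ : ∀ a j → K (m ↑ʳ a) (j ↑ˡ k) ≡ (j ==ᶠ u) ∧ adj H (pI a) w
  sumAdj-↑ʳ-↑ˡ a j rewrite splitAt-↑ʳ m k a | splitAt-↑ˡ m j k = refl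

  sumAdj-↑ʳ-↑ʳ : ∀ a b → K (m ↑ʳ a) (m ↑ʳ b) ≡ adj H (pI a) (pI b)
  sumAdj-↑ʳ-↑ʳ a b rewrite splitAt-↑ʳ m k a | splitAt-↑ʳ m k b = refl

  module _ (SG : BarbellSide G u) (SH : BarbellSide H w) where
    open BarbellSide SG renaming (W to WG; u∉W to u∉WG; W-nonempty to WG-nonempty; no-single-nbr to okG)
    open BarbellSide SH renaming (W to WH; u∉W to w∉WH; W-nonempty to WH-nonempty; no-single-nbr to okH)

    sidesPart : Fin (m + k) → Part
    sidesPart x = [ mark W₁ ∘ WG , mark W₂ ∘ WH ∘ pI ]′ (splitAt m x)

    sidesPart-↑ˡ : ∀ i → sidesPart (i ↑ˡ k) ≡ mark W₁ (WG i)
    sidesPart-↑ˡ i rewrite splitAt-↑ˡ m i k = refl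

    sidesPart-↑ʳ : ∀ b → sidesPart (m ↑ʳ b) ≡ mark W₂ (WH (pI b))
    sidesPart-↑ʳ b rewrite splitAt-↑ʳ m k b = refl

    sidesPart-W₁-nonempty : ∃ λ x → sidesPart x ≡ W₁
    sidesPart-W₁-nonempty = let i , Wi = WG-nonempty in
      i ↑ˡ k , trans (sidesPart-↑ˡ i) (cong (mark W₁) Wi)

    sidesPart-W₂-nonempty : ∃ λ x → sidesPart x ≡ W₂
    sidesPart-W₂-nonempty = let y , Wy = WH-nonempty ; w≢y = WH⇒≢w Wy in
      m ↑ʳ punchOut w≢y ,
      trans (sidesPart-↑ʳ _) (cong (mark W₂) (trans (cong WH (punchIn-punchOut w≢y)) Wy))
      where
      WH⇒≢w : ∀ {y} → WH y ≡ true → w ≢ y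
      WH⇒≢w Wy refl with () ← trans (sym Wy) w∉WH

    sidesPart-no-W₁W₂-edge : ∀ x y → sidesPart x ≡ W₁ → sidesPart y ≡ W₂ → K x y ≡ false
    sidesPart-no-W₁W₂-edge x y px py with sumView m x | sumView m y
    ... | right a | _       with () ← proj₁ (mark≡ {W₂} {WH (pI a)} (trans (sym (sidesPart-↑ʳ a)) px) λ ())
    ... | left i  | left j  with () ← proj₁ (mark≡ {W₁} {WG j} (trans (sym (sidesPart-↑ˡ j)) py) λ ())
    ... | left i  | right b = sumAdj-≢u-↑ʳ i≢u b
      where
      i≢u : i ≢ u
      i≢u refl with () ← trans (sym (proj₂ (mark≡ {W₁} {WG u} (trans (sym (sidesPart-↑ˡ u)) px) λ ()))) u∉WG

    nbrsIn-split : ∀ x c → c ≢ R → nbrsIn K sidesPart x c ≡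
      count (λ j → K x (j ↑ˡ k) ∧ (WG j ∧ (W₁ ==ᴾ c))) +
      count (λ b → K x (m ↑ʳ b) ∧ (WH (pI b) ∧ (W₂ ==ᴾ c)))
    nbrsIn-split x c c≢R = trans (nbrsIn≡count K sidesPart x c) (trans (count-↑ {m} {k} _) (cong₂ _+_
      (count-cong λ j → cong (K x (j ↑ˡ k) ∧_)
        (trans (cong (_==ᴾ c) (sidesPart-↑ˡ j)) (mark-==ᴾ W₁ (WG j) c c≢R)))
      (count-cong λ b → cong (K x (m ↑ʳ b) ∧_)
        (trans (cong (_==ᴾ c) (sidesPart-↑ʳ b)) (mark-==ᴾ W₂ (WH (pI b)) c c≢R)))))

    nbrsIn-W₁ : ∀ x → nbrsIn K sidesPart x W₁ ≡ count (λ j → K x (j ↑ˡ k) ∧ WG j)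
    nbrsIn-W₁ x = trans (nbrsIn-split x W₁ (λ ())) (trans (cong₂ _+_
      (count-cong λ j → cong (K x (j ↑ˡ k) ∧_) (∧-identityʳ (WG j)))
      (count-false λ b → ∧-false (K x (m ↑ʳ b)) (WH (pI b))))
      (+-identityʳ _))

    nbrsIn-W₂ : ∀ x → nbrsIn K sidesPart x W₂ ≡ count (λ b → K x (m ↑ʳ b) ∧ WH (pI b))
    nbrsIn-W₂ x = trans (nbrsIn-split x W₂ (λ ())) (cong₂ _+_
      (count-false λ j → ∧-false (K x (j ↑ˡ k)) (WG j))
      (count-cong λ b → cong (K x (m ↑ʳ b) ∧_) (∧-identityʳ (WH (pI b)))))

    nbrsIn-↑ˡ-W₁ : ∀ i → nbrsIn K sidesPart (i ↑ˡ k) W₁ ≡ count (λ j → adj G i j ∧ WG j)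
    nbrsIn-↑ˡ-W₁ i = trans (nbrsIn-W₁ _) (count-cong λ j → cong (_∧ WG j) (sumAdj-↑ˡ-↑ˡ i j))

    nbrsIn-↑ʳ-W₁ : ∀ a → nbrsIn K sidesPart (m ↑ʳ a) W₁ ≡ 0
    nbrsIn-↑ʳ-W₁ a = trans (nbrsIn-W₁ _)
      (count-false λ j → trans (cong (_∧ WG j) (sumAdj-↑ʳ-↑ˡ a j)) (u∉WG-∧ j _))
      where
      u∉WG-∧ : ∀ j b → ((j ==ᶠ u) ∧ b) ∧ WG j ≡ false
      u∉WG-∧ j b with j ≟ᶠ u
      ... | yes refl = trans (cong (b ∧_) u∉WG) (∧-zeroʳ b)
      ... | no  _    = refl

    countH-punchIn : ∀ y → count (λ b → adj H y (pI b) ∧ WH (pI b)) ≡ count (λ z → adj H y z ∧ WH z)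
    countH-punchIn y = sym (count-punchIn-false (λ z → adj H y z ∧ WH z) w
      (trans (cong (adj H y w ∧_) w∉WH) (∧-zeroʳ _)))

    nbrsIn-↑ʳ-W₂ : ∀ a → nbrsIn K sidesPart (m ↑ʳ a) W₂ ≡ count (λ z → adj H (pI a) z ∧ WH z)
    nbrsIn-↑ʳ-W₂ a = trans (nbrsIn-W₂ _)
      (trans (count-cong λ b → cong (_∧ WH (pI b)) (sumAdj-↑ʳ-↑ʳ a b)) (countH-punchIn (pI a)))

    nbrsIn-u-W₂ : nbrsIn K sidesPart (u ↑ˡ k) W₂ ≡ count (λ z → adj H w z ∧ WH z)
    nbrsIn-u-W₂ = trans (nbrsIn-W₂ _)
      (trans (count-cong λ b → cong (_∧ WH (pI b)) (sumAdj-u-↑ʳ b)) (countH-punchIn w))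

    nbrsIn-≢u-W₂ : ∀ {i} → i ≢ u → nbrsIn K sidesPart (i ↑ˡ k) W₂ ≡ 0
    nbrsIn-≢u-W₂ i≢u = trans (nbrsIn-W₂ _)
      (count-false λ b → cong (_∧ WH (pI b)) (sumAdj-≢u-↑ʳ i≢u b))

    sidesPart-R-nbrs₁ : ∀ r → sidesPart r ≡ R → nbrsIn K sidesPart r W₁ ≢ 1
    sidesPart-R-nbrs₁ r pr with sumView m r
    ... | left i  = okG i (mark≡R (λ ()) (trans (sym (sidesPart-↑ˡ i)) pr)) ∘ trans (sym (nbrsIn-↑ˡ-W₁ i))
    ... | right a = 0≢1+n ∘ trans (sym (nbrsIn-↑ʳ-W₁ a))

    sidesPart-R-nbrs₂ : ∀ r → sidesPart r ≡ R → nbrsIn K sidesPart r W₂ ≢ 1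
    sidesPart-R-nbrs₂ r pr with sumView m r
    ... | right a = okH (pI a) (mark≡R (λ ()) (trans (sym (sidesPart-↑ʳ a)) pr)) ∘ trans (sym (nbrsIn-↑ʳ-W₂ a))
    ... | left i with i ≟ᶠ u
    ...   | yes refl = okH w w∉WH ∘ trans (sym nbrsIn-u-W₂)
    ...   | no  i≢u  = 0≢1+n ∘ trans (sym (nbrsIn-≢u-W₂ i≢u))

    vertexSum-barbell : HasBarbellPartition K
    vertexSum-barbell = sidesPart , record
      { W₁-nonempty  = sidesPart-W₁-nonempty
      ; W₂-nonempty  = sidesPart-W₂-nonempty
      ; no-W₁W₂-edge = sidesPart-no-W₁W₂-edge
      ; R-nbrs₁      = sidesPart-R-nbrs₁
      ; R-nbrs₂      = sidesPart-R-nbrs₂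
      }

induced-bijection⇒IsPath : ∀ {m n} (G : Graph m) (f : Fin n → Fin m) (g : Fin m → Fin n) →
  (∀ z → f (g z) ≡ z) → (∀ a → g (f a) ≡ a) →
  (∀ a b → adj G (f a) (f b) ≡ pathAdj a b) → IsPath G
induced-bijection⇒IsPath G f g f∘g g∘f induced with refl ← ↔⇒≡ (mk↔ₛ′ f g f∘g g∘f) =
  mk↔ₛ′ g f g∘f f∘g ,
  λ a b → trans (cong₂ (adj G) (sym (f∘g a)) (sym (f∘g b))) (induced (g a) (g b))

module _ {m} (G : Graph m) (u : Fin m) where

  -- vertex zero is the free end, at which the path grows
  record PendantPath (ℓ : ℕ) : Set where
    field
      vertex    : Fin (suc ℓ) → Fin m
      injective : ∀ {a b} → vertex a ≡ vertex b → a ≡ b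
      induced   : ∀ a b → adj G (vertex a) (vertex b) ≡ pathAdj a b
      closed    : ∀ a {z} → adj G (vertex (suc a)) z ≡ true → ∃ λ b → vertex b ≡ z
      through-u : ∃ λ b → vertex b ≡ u

  open PendantPath

  OnPath : ∀ {ℓ} → PendantPath ℓ → Fin m → Set
  OnPath P z = ∃ λ b → vertex P b ≡ z

  onPath? : ∀ {ℓ} (P : PendantPath ℓ) z → Dec (OnPath P z)
  onPath? P z = any? λ b → vertex P b ≟ᶠ z

  offPath : ∀ {ℓ} → PendantPath ℓ → Fin m → Bool
  offPath P z = does (¬? (onPath? P z))

  offPath≡true⇒ : ∀ {ℓ} (P : PendantPath ℓ) {z} → offPath P z ≡ true → ¬ OnPath P z
  offPath≡true⇒ P {z} = does≡true⇒ (¬? (onPath? P z))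

  offPath≡false⇒ : ∀ {ℓ} (P : PendantPath ℓ) {z} → offPath P z ≡ false → OnPath P z
  offPath≡false⇒ P {z} e = decidable-stable (onPath? P z) (does≡false⇒ (¬? (onPath? P z)) e)

  OnPath⇒offPath≡false : ∀ {ℓ} (P : PendantPath ℓ) {z} → OnPath P z → offPath P z ≡ false
  OnPath⇒offPath≡false P {z} on = dec-false (¬? (onPath? P z)) (λ off → off on)

  headOffNbr : ∀ {ℓ} → PendantPath ℓ → Fin m → Bool
  headOffNbr P y = adj G (vertex P zero) y ∧ offPath P y

  interior-no-offNbr : ∀ {ℓ} (P : PendantPath ℓ) a y → adj G (vertex P (suc a)) y ∧ offPath P y ≡ false
  interior-no-offNbr P a y with adj G (vertex P (suc a)) y in e
  ... | true  = OnPath⇒offPath≡false P (closed P a e)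
  ... | false = refl

  trivialPath : PendantPath 0
  trivialPath = record
    { vertex    = λ _ → u
    ; injective = λ { {zero} {zero} _ → refl }
    ; induced   = λ { zero zero → irrefl G u }
    ; closed    = λ ()
    ; through-u = zero , refl
    }

  covering⇒IsPath : ∀ {ℓ} (P : PendantPath ℓ) → count (offPath P) ≡ 0 → IsPath G
  covering⇒IsPath P e = induced-bijection⇒IsPath G (vertex P) (proj₁ ∘ onPath) (proj₂ ∘ onPath)
    (λ a → injective P (proj₂ (onPath (vertex P a)))) (induced P)
    where
    onPath : ∀ z → OnPath P z
    onPath z = offPath≡false⇒ P (count≡0⇒false e z)

  stuck⇒BarbellSide : ∀ {ℓ n} (P : PendantPath ℓ) → count (offPath P) ≡ suc n →
    count (headOffNbr P) ≢ 1 → BarbellSide G u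
  stuck⇒BarbellSide P e head≢1 = record
    { W             = offPath P
    ; u∉W           = OnPath⇒offPath≡false P (through-u P)
    ; W-nonempty    = count≡suc⇒∃ e
    ; no-single-nbr = no-single-nbr
    }
    where
    no-single-nbr : ∀ r → offPath P r ≡ false → count (λ y → adj G r y ∧ offPath P y) ≢ 1
    no-single-nbr r off with offPath≡false⇒ P off
    ... | zero  , refl = head≢1
    ... | suc a , refl = 0≢1+n ∘ trans (sym (count-false (interior-no-offNbr P a)))

  module _ {ℓ} (P : PendantPath ℓ) (single : count (headOffNbr P) ≡ 1) where

    private
      next : Fin m
      next = proj₁ (count≡suc⇒∃ {p = headOffNbr P} single)

      next-headOffNbr : headOffNbr P next ≡ true
      next-headOffNbr = proj₂ (count≡suc⇒∃ {p = headOffNbr P} single)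

      next-adj : adj G (vertex P zero) next ≡ true
      next-adj = proj₁ (∧≡true⇒ next-headOffNbr)

      next-off : offPath P next ≡ true
      next-off = proj₂ (∧≡true⇒ next-headOffNbr)

      next-new : ∀ b → vertex P b ≢ next
      next-new b vb = offPath≡true⇒ P next-off (b , vb)

      next-far : ∀ a → adj G (vertex P (suc a)) next ≡ false
      next-far a = trans (sym (∧-identityʳ _))
        (trans (cong (adj G (vertex P (suc a)) next ∧_) (sym next-off)) (interior-no-offNbr P a next))

      vertex′ : Fin (suc (suc ℓ)) → Fin m
      vertex′ = next ∷ vertex P

      injective′ : ∀ {a b} → vertex′ a ≡ vertex′ b → a ≡ b
      injective′ {zero}  {zero}  _  = refl
      injective′ {zero}  {suc b} eq = ⊥-elim (next-new b (sym eq))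
      injective′ {suc a} {zero}  eq = ⊥-elim (next-new a eq)
      injective′ {suc a} {suc b} eq = cong suc (injective P eq)

      induced′ : ∀ a b → adj G (vertex′ a) (vertex′ b) ≡ pathAdj a b
      induced′ zero          zero          = irrefl G next
      induced′ zero          (suc zero)    = trans (Graph.sym G next _) next-adj
      induced′ zero          (suc (suc b)) = trans (Graph.sym G next _) (next-far b)
      induced′ (suc zero)    zero          = next-adj
      induced′ (suc (suc a)) zero          = next-far a
      induced′ (suc a)       (suc b)       = induced P a b

      closed′ : ∀ a {z} → adj G (vertex′ (suc a)) z ≡ true → ∃ λ b → vertex′ b ≡ z
      closed′ (suc a) e = let b , vb = closed P a e in suc b , vb
      closed′ zero {z} e with offPath P z in off
      ... | false = let b , vb = offPath≡false⇒ P off in suc b , vb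
      ... | true  = zero , count≡1⇒unique single next-headOffNbr (cong₂ _∧_ e off)

    extend : PendantPath (suc ℓ)
    extend = record
      { vertex    = vertex′
      ; injective = injective′
      ; induced   = induced′
      ; closed    = closed′
      ; through-u = let b , vb = through-u P in suc b , vb
      }

    count-offPath-extend : count (offPath P) ≡ suc (count (offPath extend))
    count-offPath-extend = count-remove (offPath P) (offPath extend) next next-off
      (OnPath⇒offPath≡false extend (zero , refl))
      (λ z z≢next → cong not (does-⇔ (on⇔on′ z≢next) (onPath? P z) (onPath? extend z)))
      where
      on⇔on′ : ∀ {z} → z ≢ next → OnPath P z ⇔ OnPath extend z
      on⇔on′ z≢next = mk⇔ (λ (b , vb) → suc b , vb)
        λ { (zero , vb) → ⊥-elim (z≢next (sym vb)) ; (suc b , vb) → b , vb }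

  module _ (¬path : ¬ IsPath G) where

    grow : ∀ n {ℓ} (P : PendantPath ℓ) → count (offPath P) ≡ n → BarbellSide G u
    grow zero    P e = ⊥-elim (¬path (covering⇒IsPath P e))
    grow (suc n) P e with count (headOffNbr P) ≟ℕ 1
    ... | no  ≢1 = stuck⇒BarbellSide P e ≢1
    ... | yes ≡1 = grow n (extend P ≡1) (suc-injective (trans (sym (count-offPath-extend P ≡1)) e))

    ¬IsPath⇒BarbellSide : BarbellSide G u
    ¬IsPath⇒BarbellSide = grow _ trivialPath refl

mainTheorem11 : ∀ {m k} (G : Graph m) (H : Graph (suc k)) →
    ¬ IsPath G → ¬ IsPath H →
    (u : Fin m) (w : Fin (suc k)) → HasBarbellPartition (VertexSum G u H w)
mainTheorem11 G H ¬pathG ¬pathH u w =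
  vertexSum-barbell G u H w (¬IsPath⇒BarbellSide G u ¬pathG) (¬IsPath⇒BarbellSide H w ¬pathH)
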